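{- For every two finite graphs $G$ and $H$ (each with at least one vertex) we have \[ i(G\times H)\le \max\{a(G),a(H)\}. \]
   Context: All graphs are finite, simple and undirected. For a graph $G$, $\alpha(G)$ is its independence number and $i(G)=\frac{\alpha(G)}{|V(G)|}$ is its independence ratio. For a set $U\subseteq V(G)$, $N_G(U)$ denotes the neighborhood of $U$ in $G$, i.e. the set of vertices adjacent to some vertex of $U$. Define \[ a(G)=\max\left\{\frac{|U|}{|U|+|N_G(U)|}\ :\ U \text{ a nonempty independent set of } G\right\}. \] The categorical (direct, tensor) product $G\times H$ has vertex set $V(G)\times V(H)$, and $\{(x_1,y_1),(x_2,y_2)\}$ is an edge iff $\{x_1,x_2\}\in E(G)$ and $\{y_1,y_2\}\in E(H)$. -}

module Defs where

open import Data.Nat using (ℕ; zero; suc; _+_; _*_)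
open import Data.Bool using (Bool; true; false; _∧_; _∨_; not; if_then_else_)
open import Data.Fin using (Fin; remQuot)
open import Data.Fin.Subset using (Subset; inside; outside; ∣_∣)
open import Data.Vec using (Vec; []; _∷_; lookup; tabulate)
open import Data.List using (List; []; _∷_; map; _++_; foldr; filter; allFin)
import Data.List as L
open import Data.Integer using (+_)
open import Data.Rational using (ℚ; 0ℚ; _/_; _⊔_)
open import Data.Product using (_×_; _,_; proj₁; proj₂)
open import Relation.Binary.PropositionalEquality using (_≡_)

record Graph : Set where
  field
    n   : ℕ
    adj : Fin n → Fin n → Bool
open Graph public

record IsSimple (G : Graph) : Set where
  field
    symmetric   : ∀ x y → adj G x y ≡ adj G y x
    irreflexive : ∀ x → adj G x x ≡ false

-- Categorical (tensor) product; vertex (x , y) is encoded as combine x y : Fin (n G * n H),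
-- decoded by remQuot.
_×ᴳ_ : Graph → Graph → Graph
G ×ᴳ H = record
  { n   = n G * n H
  ; adj = λ p q →
      let (x₁ , y₁) = remQuot (n H) p
          (x₂ , y₂) = remQuot (n H) q
      in adj G x₁ x₂ ∧ adj H y₁ y₂
  }

allSubsets : ∀ k → List (Subset k)
allSubsets zero    = [] ∷ []
allSubsets (suc k) = map (inside ∷_) (allSubsets k) ++ map (outside ∷_) (allSubsets k)

anyV : ∀ {k} → (Fin k → Bool) → Bool
anyV f = foldr (λ x b → f x ∨ b) false (allFin _)

allV : ∀ {k} → (Fin k → Bool) → Bool
allV f = foldr (λ x b → f x ∧ b) true (allFin _)

independent : (G : Graph) → Subset (n G) → Bool
independent G U =
  allV (λ x → allV (λ y → not (lookup U x ∧ lookup U y ∧ adj G x y)))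

nonempty : ∀ {k} → Subset k → Bool
nonempty U = anyV (lookup U)

nbhd : (G : Graph) → Subset (n G) → Subset (n G)
nbhd G U = tabulate (λ x → anyV (λ u → lookup U u ∧ adj G u x))

-- k / m as a rational (m = 0 never occurs in the uses below; it is mapped to 0)
ratio : ℕ → ℕ → ℚ
ratio k zero    = 0ℚ
ratio k (suc m) = (+ k) / suc m

maxℚ : List ℚ → ℚ
maxℚ = foldr _⊔_ 0ℚ

maxℕ : List ℕ → ℕ
maxℕ = foldr Data.Nat._⊔_ 0

α : Graph → ℕ
α G = maxℕ (map ∣_∣ (filter (λ U → Data.Bool._≟_ (independent G U) true) (allSubsets (n G))))

i : Graph → ℚ
i G = ratio (α G) (n G)

a : Graph → ℚ
a G = maxℚ (map (λ U → ratio ∣ U ∣ (∣ U ∣ + ∣ nbhd G U ∣))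
                (filter (λ U → Data.Bool._≟_ (independent G U ∧ nonempty U) true)
                        (allSubsets (n G))))

-- Let I be independent in G × H and split it into the set A of vertices (x , y)
-- having no neighbour (x , y') ∈ I in their row, and the rest B. Each row
-- A_x = {y | (x , y) ∈ A} is independent in H. Each column B^y is independent in G:
-- if (u , y), (v , y) ∈ B with u ~ v, the row neighbour (u , y') ∈ I of (u , y) is
-- adjacent to (v , y) in G × H. At every cell (x , y) the four conditions y ∈ A_x,
-- y ∈ N(A_x), x ∈ B^y, x ∈ N(B^y) are mutually exclusive, so
--   Σ_x (|A_x| + |N(A_x)|) + Σ_y (|B^y| + |N(B^y)|) ≤ |G| |H|,
-- and with |A_x| ≤ a(H) (|A_x| + |N(A_x)|) and |B^y| ≤ a(G) (|B^y| + |N(B^y)|) this gives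
-- |I| = Σ_x |A_x| + Σ_y |B^y| ≤ max (a(G), a(H)) |G| |H|.
module Submission where

open import Defs
open import Data.Nat using (ℕ; zero; suc; _+_; _*_; _≤_; _≥_; z≤n; s≤s)
open import Data.Nat.Properties
  using (+-assoc; +-identityʳ; *-identityʳ; *-distribˡ-+; *-distribʳ-+; *-distribʳ-⊔; *-monoʳ-≤;
         +-mono-≤; ⊔-lub; ≤-reflexive; module ≤-Reasoning)
  renaming (+-*-semiring to ℕ-semiring; ≤-trans to ≤ℕ-trans)
open import Data.Bool using (Bool; true; false; _∧_; _∨_; not; _≟_)
open import Data.Fin using (Fin; combine; _↑ˡ_; _↑ʳ_) renaming (zero to 0F; suc to 1+)
open import Data.Fin.Properties using (remQuot-combine)
open import Data.Fin.Subset using (Subset; ∣_∣)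
open import Data.Vec using ([]; _∷_; lookup; tabulate)
open import Data.Vec.Properties using (lookup∘tabulate)
open import Data.List using ([]; _∷_; map; filter; foldr; allFin)
import Data.List.Relation.Unary.All as All
import Data.Nat.ListAction as ListAction
open import Data.List.Relation.Unary.All using (All; []; _∷_)
open import Data.List.Relation.Unary.All.Properties using (map⁺; all-filter)
open import Data.List.Relation.Unary.AllPairs using (AllPairs; []; _∷_)
open import Data.List.Relation.Unary.Any using (here; there)
open import Data.List.Membership.Propositional using (_∈_)
open import Data.List.Membership.Propositional.Properties
  using (∈-map⁺; ∈-filter⁺; ∈-allFin; ∈-++⁺ˡ; ∈-++⁺ʳ)
open import Data.Integer using (-[1+_]; +≤+)
import Data.Integer as ℤ
import Data.Integer.Properties as ℤ
open import Data.Rational using (mkℚ; 0ℚ; _⊔_; *≤*) renaming (_≤_ to _≤ℚ_)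
open import Data.Rational.Properties
  using (p≤p⊔q; p≤q⊔p; ≤-trans; ≤-refl; toℚᵘ-mono-≤; toℚᵘ-cancel-≤; toℚᵘ-fromℚᵘ; nonNegative⁻¹)
open import Data.Rational.Unnormalised using (mkℚᵘ)
import Data.Rational.Unnormalised as ℚᵘ
import Data.Rational.Unnormalised.Properties as ℚᵘ
open import Data.Nat.Coprimality using (Coprime)
open import Data.Product using (∃; _×_; _,_; proj₁; proj₂)
open import Data.Empty using (⊥; ⊥-elim)
open import Relation.Binary.PropositionalEquality
  using (_≡_; refl; sym; trans; cong; cong₂; subst; module ≡-Reasoning)
open import Algebra.Properties.Semiring.Sum ℕ-semiring
  using (sum; sum-syntax; ∑-distrib-+; ∑-comm; *-distribˡ-sum; *-distribʳ-sum; sum-cong-≗)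

Undirected : Graph → Set
Undirected K = ∀ x y → adj K x y ≡ adj K y x

Disjoint : Bool → Bool → Set
Disjoint a b = a ≡ true → b ≡ true → ⊥

∧-true⁻ : ∀ {a b} → a ∧ b ≡ true → a ≡ true × b ≡ true
∧-true⁻ {true} b≡true = refl , b≡true

not-disjoint : ∀ b → Disjoint (not b) b
not-disjoint true ()

not-∧-∧-true : ∀ a b c → (a ≡ true → b ≡ true → c ≡ true → ⊥) → not (a ∧ b ∧ c) ≡ true
not-∧-∧-true true  true  true  abc⇒⊥ = ⊥-elim (abc⇒⊥ refl refl refl)
not-∧-∧-true true  true  false _     = refl
not-∧-∧-true true  false _     _     = refl
not-∧-∧-true false _     _     _     = refl

module _ {A : Set} (f : A → Bool) where

  foldr-∨-true⁻ : ∀ xs → foldr (λ x b → f x ∨ b) false xs ≡ true → ∃ λ x → f x ≡ true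
  foldr-∨-true⁻ (x ∷ xs) any≡true with f x in fx≡b
  ... | true  = x , fx≡b
  ... | false = foldr-∨-true⁻ xs any≡true

  foldr-∨-true⁺ : ∀ {x} xs → x ∈ xs → f x ≡ true → foldr (λ x b → f x ∨ b) false xs ≡ true
  foldr-∨-true⁺ (y ∷ ys) (here refl) fy≡true rewrite fy≡true = refl
  foldr-∨-true⁺ (y ∷ ys) (there x∈ys) fx≡true with f y
  ... | true  = refl
  ... | false = foldr-∨-true⁺ ys x∈ys fx≡true

  foldr-∧-true⁻ : ∀ {x} xs → foldr (λ x b → f x ∧ b) true xs ≡ true → x ∈ xs → f x ≡ true
  foldr-∧-true⁻ (y ∷ ys) all≡true (here refl)  = ∧-true⁻ all≡true .proj₁
  foldr-∧-true⁻ (y ∷ ys) all≡true (there x∈ys) =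
    foldr-∧-true⁻ ys (∧-true⁻ {f y} all≡true .proj₂) x∈ys

  foldr-∧-true⁺ : (∀ x → f x ≡ true) → ∀ xs → foldr (λ x b → f x ∧ b) true xs ≡ true
  foldr-∧-true⁺ f≡true []       = refl
  foldr-∧-true⁺ f≡true (y ∷ ys) rewrite f≡true y = foldr-∧-true⁺ f≡true ys

anyV-true⁻ : ∀ {k} (f : Fin k → Bool) → anyV f ≡ true → ∃ λ x → f x ≡ true
anyV-true⁻ f = foldr-∨-true⁻ f (allFin _)

anyV-true⁺ : ∀ {k} (f : Fin k → Bool) x → f x ≡ true → anyV f ≡ true
anyV-true⁺ f x = foldr-∨-true⁺ f (allFin _) (∈-allFin x)

allV-true⁻ : ∀ {k} (f : Fin k → Bool) → allV f ≡ true → ∀ x → f x ≡ true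
allV-true⁻ f all≡true x = foldr-∧-true⁻ f (allFin _) all≡true (∈-allFin x)

allV-true⁺ : ∀ {k} (f : Fin k → Bool) → (∀ x → f x ≡ true) → allV f ≡ true
allV-true⁺ f f≡true = foldr-∧-true⁺ f f≡true (allFin _)

independent⁻ : (K : Graph) {U : Subset (n K)} → independent K U ≡ true →
  ∀ {u v} → lookup U u ≡ true → lookup U v ≡ true → adj K u v ≡ true → ⊥
independent⁻ K {U} U-indep {u} {v} u∈U v∈U uv∈E =
  not-disjoint (lookup U u ∧ lookup U v ∧ adj K u v) (allV-true⁻ _ (allV-true⁻ _ U-indep u) v)
    (cong₂ _∧_ u∈U (cong₂ _∧_ v∈U uv∈E))

independent-tabulate⁺ : (K : Graph) (f : Fin (n K) → Bool) →
  (∀ u v → f u ≡ true → f v ≡ true → adj K u v ≡ true → ⊥) → independent K (tabulate f) ≡ true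
independent-tabulate⁺ K f f-indep = allV-true⁺ _ λ u → allV-true⁺ _ λ v → cell u v
  where
  cell : ∀ u v → not (lookup (tabulate f) u ∧ lookup (tabulate f) v ∧ adj K u v) ≡ true
  cell u v rewrite lookup∘tabulate f u | lookup∘tabulate f v =
    not-∧-∧-true (f u) (f v) (adj K u v) (f-indep u v)

nbhd-tabulate⁻ : (K : Graph) (f : Fin (n K) → Bool) {v : Fin (n K)} →
  lookup (nbhd K (tabulate f)) v ≡ true → ∃ λ u → f u ≡ true × adj K u v ≡ true
nbhd-tabulate⁻ K f {v} v∈N with anyV-true⁻ _ (trans (sym (lookup∘tabulate _ v)) v∈N)
... | u , u∈U∧uv∈E with ∧-true⁻ u∈U∧uv∈E
...   | u∈U , uv∈E = u , trans (sym (lookup∘tabulate f u)) u∈U , uv∈E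

adj-×ᴳ-combine : (G H : Graph) (x x' : Fin (n G)) (y y' : Fin (n H)) →
  adj (G ×ᴳ H) (combine x y) (combine x' y') ≡ adj G x x' ∧ adj H y y'
adj-×ᴳ-combine G H x x' y y' =
  cong₂ (λ (p q : Fin (n G) × Fin (n H)) → adj G (p .proj₁) (q .proj₁) ∧ adj H (p .proj₂) (q .proj₂))
        (remQuot-combine x y) (remQuot-combine x' y')

𝟙 : Bool → ℕ
𝟙 true  = 1
𝟙 false = 0

𝟙-split : ∀ a b → 𝟙 a ≡ 𝟙 (a ∧ not b) + 𝟙 (a ∧ b)
𝟙-split true  true  = refl
𝟙-split true  false = refl
𝟙-split false _     = refl

∑𝟙-pairwise-disjoint : ∀ {bs} → AllPairs Disjoint bs → ListAction.sum (map 𝟙 bs) ≤ 1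
∑𝟙-pairwise-disjoint [] = z≤n
∑𝟙-pairwise-disjoint {false ∷ bs} (_ ∷ disjoint) = ∑𝟙-pairwise-disjoint disjoint
∑𝟙-pairwise-disjoint {true ∷ bs} (true-disjoint ∷ _) = s≤s (≤-reflexive (all-false true-disjoint))
  where
  all-false : ∀ {bs} → All (Disjoint true) bs → ListAction.sum (map 𝟙 bs) ≡ 0
  all-false [] = refl
  all-false {false ∷ _} (_ ∷ rest) = all-false rest
  all-false {true ∷ _} (true-disjoint ∷ _) = ⊥-elim (true-disjoint refl refl)

∣p∣≡∑𝟙 : ∀ {k} (U : Subset k) → ∣ U ∣ ≡ ∑[ x < k ] 𝟙 (lookup U x)
∣p∣≡∑𝟙 []          = refl
∣p∣≡∑𝟙 (true ∷ U)  = cong suc (∣p∣≡∑𝟙 U)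
∣p∣≡∑𝟙 (false ∷ U) = ∣p∣≡∑𝟙 U

∣tabulate∣≡∑𝟙 : ∀ {k} (f : Fin k → Bool) → ∣ tabulate f ∣ ≡ ∑[ x < k ] 𝟙 (f x)
∣tabulate∣≡∑𝟙 f =
  trans (∣p∣≡∑𝟙 (tabulate f)) (sum-cong-≗ (λ x → cong 𝟙 (lookup∘tabulate f x)))

∑-mono-≤ : ∀ {k} {f g : Fin k → ℕ} → (∀ x → f x ≤ g x) → sum f ≤ sum g
∑-mono-≤ {zero}  f≤g = z≤n
∑-mono-≤ {suc k} f≤g = +-mono-≤ (f≤g 0F) (∑-mono-≤ (λ x → f≤g (1+ x)))

∑-const : ∀ k c → ∑[ x < k ] c ≡ k * c
∑-const zero    c = refl
∑-const (suc k) c = cong (c +_) (∑-const k c)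

∑-↑ : ∀ m {k} (f : Fin (m + k) → ℕ) → sum f ≡ ∑[ x < m ] f (x ↑ˡ k) + ∑[ y < k ] f (m ↑ʳ y)
∑-↑ zero    f = refl
∑-↑ (suc m) f = trans (cong (f 0F +_) (∑-↑ m (λ x → f (1+ x)))) (sym (+-assoc (f 0F) _ _))

∑-combine : ∀ m {k} (f : Fin (m * k) → ℕ) → sum f ≡ ∑[ x < m ] ∑[ y < k ] f (combine x y)
∑-combine zero    f = refl
∑-combine (suc m) {k} f =
  trans (∑-↑ k {m * k} f) (cong (∑[ y < k ] f (combine {suc m} 0F y) +_) (∑-combine m (λ z → f (k ↑ʳ z))))

∑-ratio≤ : ∀ {k} d p (f g : Fin k → ℕ) → (∀ x → f x * d ≤ p * g x) → sum f * d ≤ p * sum g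
∑-ratio≤ d p f g f/g≤p/d = begin
  sum f * d                ≡⟨ *-distribʳ-sum d f ⟩
  ∑[ x < _ ] (f x * d)     ≤⟨ ∑-mono-≤ f/g≤p/d ⟩
  ∑[ x < _ ] (p * g x)     ≡⟨ sym (*-distribˡ-sum p g) ⟩
  p * sum g                ∎
  where open ≤-Reasoning

rows+columns≤grid : ∀ {m k} (R C : Fin m → Fin k → ℕ) → (∀ x y → R x y + C x y ≤ 1) →
  ∑[ x < m ] ∑[ y < k ] R x y + ∑[ y < k ] ∑[ x < m ] C x y ≤ m * k
rows+columns≤grid {m} {k} R C cell≤1 = begin
  ∑[ x < m ] ∑[ y < k ] R x y + ∑[ y < k ] ∑[ x < m ] C x y
    ≡⟨ cong (∑[ x < m ] ∑[ y < k ] R x y +_) (∑-comm (λ y x → C x y)) ⟩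
  ∑[ x < m ] ∑[ y < k ] R x y + ∑[ x < m ] ∑[ y < k ] C x y
    ≡⟨ sym (∑-distrib-+ (λ x → ∑[ y < k ] R x y) _) ⟩
  ∑[ x < m ] (∑[ y < k ] R x y + ∑[ y < k ] C x y)
    ≡⟨ sum-cong-≗ (λ x → sym (∑-distrib-+ (R x) (C x))) ⟩
  ∑[ x < m ] ∑[ y < k ] (R x y + C x y)
    ≤⟨ ∑-mono-≤ (λ x → ∑-mono-≤ (cell≤1 x)) ⟩
  ∑[ x < m ] ∑[ y < k ] 1
    ≡⟨ trans (sum-cong-≗ {m} (λ _ → trans (∑-const k 1) (*-identityʳ k))) (∑-const m k) ⟩
  m * k ∎
  where open ≤-Reasoning

-- a(K) ≤ p / d with denominators cleared; the empty set satisfies it trivially.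
ABound : Graph → ℕ → ℕ → Set
ABound K p d = ∀ U → independent K U ≡ true → ∣ U ∣ * d ≤ p * (∣ U ∣ + ∣ nbhd K U ∣)

ABound-tabulate : (K : Graph) {p d : ℕ} → ABound K p d → (f : Fin (n K) → Bool) →
  independent K (tabulate f) ≡ true →
  (∑[ v < n K ] 𝟙 (f v)) * d ≤ p * ∑[ v < n K ] (𝟙 (f v) + 𝟙 (lookup (nbhd K (tabulate f)) v))
ABound-tabulate K {p} {d} bound f U-indep = begin
  (∑[ v < n K ] 𝟙 (f v)) * d        ≡⟨ cong (_* d) (sym (∣tabulate∣≡∑𝟙 f)) ⟩
  ∣ U ∣ * d                         ≤⟨ bound U U-indep ⟩
  p * (∣ U ∣ + ∣ nbhd K U ∣)
                                    ≡⟨ cong (p *_) (cong₂ _+_ (∣tabulate∣≡∑𝟙 f) (∣p∣≡∑𝟙 (nbhd K U))) ⟩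
  p * (∑[ v < n K ] 𝟙 (f v) + ∑[ v < n K ] 𝟙 (lookup (nbhd K U) v))
                                    ≡⟨ cong (p *_) (sym (∑-distrib-+ (λ v → 𝟙 (f v)) _)) ⟩
  p * ∑[ v < n K ] (𝟙 (f v) + 𝟙 (lookup (nbhd K U) v)) ∎
  where
  open ≤-Reasoning
  U = tabulate f

module RowColumnSplit (G H : Graph) (G-undirected : Undirected G) (H-undirected : Undirected H)
  (I : Subset (n G * n H)) (I-independent : independent (G ×ᴳ H) I ≡ true) where

  J : Fin (n G) → Fin (n H) → Bool
  J x y = lookup I (combine x y)

  J-independent : ∀ {x x' y y'} → J x y ≡ true → J x' y' ≡ true →
    adj G x x' ≡ true → adj H y y' ≡ true → ⊥
  J-independent {x} {x'} {y} {y'} xy∈I x'y'∈I xx'∈E yy'∈E =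
    independent⁻ (G ×ᴳ H) {I} I-independent xy∈I x'y'∈I
      (trans (adj-×ᴳ-combine G H x x' y y') (cong₂ _∧_ xx'∈E yy'∈E))

  hasRowNeighbour : Fin (n G) → Fin (n H) → Bool
  hasRowNeighbour x y = anyV (λ y' → J x y' ∧ adj H y y')

  A B : Fin (n G) → Fin (n H) → Bool
  A x y = J x y ∧ not (hasRowNeighbour x y)
  B x y = J x y ∧ hasRowNeighbour x y

  N[A] N[B] : Fin (n G) → Fin (n H) → Bool
  N[A] x y = lookup (nbhd H (tabulate (A x))) y
  N[B] x y = lookup (nbhd G (tabulate (λ x' → B x' y))) x

  A⇒J : ∀ {x y} → A x y ≡ true → J x y ≡ true
  A⇒J {x} {y} xy∈A = ∧-true⁻ {J x y} xy∈A .proj₁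

  A⇒no-row-neighbour : ∀ {x y y'} → A x y ≡ true → J x y' ≡ true → adj H y y' ≡ true → ⊥
  A⇒no-row-neighbour {x} {y} {y'} xy∈A xy'∈I yy'∈E =
    not-disjoint (hasRowNeighbour x y) (∧-true⁻ {J x y} xy∈A .proj₂)
      (anyV-true⁺ _ y' (cong₂ _∧_ xy'∈I yy'∈E))

  B⇒J : ∀ {x y} → B x y ≡ true → J x y ≡ true
  B⇒J {x} {y} xy∈B = ∧-true⁻ {J x y} xy∈B .proj₁

  B⇒row-neighbour : ∀ {x y} → B x y ≡ true → ∃ λ y' → J x y' ≡ true × adj H y y' ≡ true
  B⇒row-neighbour {x} {y} xy∈B with anyV-true⁻ _ (∧-true⁻ {J x y} xy∈B .proj₂)
  ... | y' , xy'∈I∧yy'∈E = y' , ∧-true⁻ xy'∈I∧yy'∈E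

  A-row-independent : ∀ x u v → A x u ≡ true → A x v ≡ true → adj H u v ≡ true → ⊥
  A-row-independent x u v xu∈A xv∈A uv∈E = A⇒no-row-neighbour xu∈A (A⇒J xv∈A) uv∈E

  B-column-independent : ∀ y u v → B u y ≡ true → B v y ≡ true → adj G u v ≡ true → ⊥
  B-column-independent y u v uy∈B vy∈B uv∈E with B⇒row-neighbour uy∈B
  ... | y' , uy'∈I , yy'∈E = J-independent uy'∈I (B⇒J vy∈B) uv∈E (trans (H-undirected y' y) yy'∈E)

  cell-disjoint : ∀ x y → AllPairs Disjoint (A x y ∷ N[A] x y ∷ B x y ∷ N[B] x y ∷ [])
  cell-disjoint x y =
      (A-N[A] ∷ A-B ∷ A-N[B] ∷ []) ∷ (N[A]-B ∷ N[A]-N[B] ∷ []) ∷ (B-N[B] ∷ []) ∷ [] ∷ []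
    where
    A-N[A] : Disjoint (A x y) (N[A] x y)
    A-N[A] xy∈A y∈N with nbhd-tabulate⁻ H (A x) y∈N
    ... | u , xu∈A , uy∈E = A-row-independent x y u xy∈A xu∈A (trans (H-undirected y u) uy∈E)

    A-B : Disjoint (A x y) (B x y)
    A-B xy∈A xy∈B with B⇒row-neighbour xy∈B
    ... | y' , xy'∈I , yy'∈E = A⇒no-row-neighbour xy∈A xy'∈I yy'∈E

    A-N[B] : Disjoint (A x y) (N[B] x y)
    A-N[B] xy∈A x∈N with nbhd-tabulate⁻ G (λ x' → B x' y) x∈N
    ... | u , uy∈B , ux∈E with B⇒row-neighbour uy∈B
    ...   | y' , uy'∈I , yy'∈E = J-independent (A⇒J xy∈A) uy'∈I (trans (G-undirected x u) ux∈E) yy'∈E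

    N[A]-B : Disjoint (N[A] x y) (B x y)
    N[A]-B y∈N xy∈B with nbhd-tabulate⁻ H (A x) y∈N
    ... | u , xu∈A , uy∈E = A⇒no-row-neighbour xu∈A (B⇒J xy∈B) uy∈E

    N[A]-N[B] : Disjoint (N[A] x y) (N[B] x y)
    N[A]-N[B] y∈N x∈N with nbhd-tabulate⁻ H (A x) y∈N | nbhd-tabulate⁻ G (λ x' → B x' y) x∈N
    ... | u , xu∈A , uy∈E | v , vy∈B , vx∈E =
      J-independent (A⇒J xu∈A) (B⇒J vy∈B) (trans (G-undirected x v) vx∈E) uy∈E

    B-N[B] : Disjoint (B x y) (N[B] x y)
    B-N[B] xy∈B x∈N with nbhd-tabulate⁻ G (λ x' → B x' y) x∈N
    ... | v , vy∈B , vx∈E = B-column-independent y x v xy∈B vy∈B (trans (G-undirected x v) vx∈E)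

  R C : Fin (n G) → Fin (n H) → ℕ
  R x y = 𝟙 (A x y) + 𝟙 (N[A] x y)
  C x y = 𝟙 (B x y) + 𝟙 (N[B] x y)

  R+C≤1 : ∀ x y → R x y + C x y ≤ 1
  R+C≤1 x y = subst (_≤ 1) (sym reassociate) (∑𝟙-pairwise-disjoint (cell-disjoint x y))
    where
    reassociate : R x y + C x y ≡ 𝟙 (A x y) + (𝟙 (N[A] x y) + (𝟙 (B x y) + (𝟙 (N[B] x y) + 0)))
    reassociate = trans (+-assoc (𝟙 (A x y)) _ _)
      (cong (λ z → 𝟙 (A x y) + (𝟙 (N[A] x y) + (𝟙 (B x y) + z))) (sym (+-identityʳ _)))

  #A #R : Fin (n G) → ℕ
  #A x = ∑[ y < n H ] 𝟙 (A x y)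
  #R x = ∑[ y < n H ] R x y

  #B #C : Fin (n H) → ℕ
  #B y = ∑[ x < n G ] 𝟙 (B x y)
  #C y = ∑[ x < n G ] C x y

  ∣I∣≡∑#A+∑#B : ∣ I ∣ ≡ ∑[ x < n G ] #A x + ∑[ y < n H ] #B y
  ∣I∣≡∑#A+∑#B = begin
    ∣ I ∣                                                  ≡⟨ ∣p∣≡∑𝟙 I ⟩
    ∑[ z < n G * n H ] 𝟙 (lookup I z)                     ≡⟨ ∑-combine (n G) _ ⟩
    ∑[ x < n G ] ∑[ y < n H ] 𝟙 (J x y)
      ≡⟨ sum-cong-≗ (λ x → sum-cong-≗ (λ y → 𝟙-split (J x y) (hasRowNeighbour x y))) ⟩
    ∑[ x < n G ] ∑[ y < n H ] (𝟙 (A x y) + 𝟙 (B x y))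
      ≡⟨ sum-cong-≗ (λ x → ∑-distrib-+ (λ y → 𝟙 (A x y)) _) ⟩
    ∑[ x < n G ] (#A x + ∑[ y < n H ] 𝟙 (B x y))
      ≡⟨ ∑-distrib-+ #A _ ⟩
    ∑[ x < n G ] #A x + ∑[ x < n G ] ∑[ y < n H ] 𝟙 (B x y)
      ≡⟨ cong (∑[ x < n G ] #A x +_) (∑-comm (λ x y → 𝟙 (B x y))) ⟩
    ∑[ x < n G ] #A x + ∑[ y < n H ] #B y ∎
    where open ≡-Reasoning

  ∣I∣-bound : ∀ {p d} → ABound G p d → ABound H p d → ∣ I ∣ * d ≤ p * (n G * n H)
  ∣I∣-bound {p} {d} G-bound H-bound = begin
    ∣ I ∣ * d                                        ≡⟨ cong (_* d) ∣I∣≡∑#A+∑#B ⟩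
    (∑[ x < n G ] #A x + ∑[ y < n H ] #B y) * d     ≡⟨ *-distribʳ-+ d (sum #A) (sum #B) ⟩
    (∑[ x < n G ] #A x) * d + (∑[ y < n H ] #B y) * d
      ≤⟨ +-mono-≤ (∑-ratio≤ d p #A #R row-bound) (∑-ratio≤ d p #B #C column-bound) ⟩
    p * ∑[ x < n G ] #R x + p * ∑[ y < n H ] #C y  ≡⟨ sym (*-distribˡ-+ p _ _) ⟩
    p * (∑[ x < n G ] #R x + ∑[ y < n H ] #C y)    ≤⟨ *-monoʳ-≤ p (rows+columns≤grid R C R+C≤1) ⟩
    p * (n G * n H)                                 ∎
    where
    open ≤-Reasoning
    row-bound : ∀ x → #A x * d ≤ p * #R x
    row-bound x = ABound-tabulate H {p} {d} H-bound (A x)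
      (independent-tabulate⁺ H (A x) (A-row-independent x))
    column-bound : ∀ y → #B y * d ≤ p * #C y
    column-bound y = ABound-tabulate G {p} {d} G-bound (λ x → B x y)
      (independent-tabulate⁺ G (λ x → B x y) (B-column-independent y))

allSubsets-complete : ∀ {k} (U : Subset k) → U ∈ allSubsets k
allSubsets-complete []                = here refl
allSubsets-complete {suc k} (true ∷ U)  = ∈-++⁺ˡ (∈-map⁺ (true ∷_) (allSubsets-complete U))
allSubsets-complete {suc k} (false ∷ U) =
  ∈-++⁺ʳ (map (true ∷_) (allSubsets k)) (∈-map⁺ (false ∷_) (allSubsets-complete U))

maxℚ-upper : ∀ {q} qs → q ∈ qs → q ≤ℚ maxℚ qs
maxℚ-upper (q ∷ qs) (here refl)  = p≤p⊔q q (maxℚ qs)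
maxℚ-upper (q ∷ qs) (there q∈qs) = ≤-trans (maxℚ-upper qs q∈qs) (p≤q⊔p q (maxℚ qs))

maxℚ-nonneg : ∀ qs → 0ℚ ≤ℚ maxℚ qs
maxℚ-nonneg []       = ≤-refl
maxℚ-nonneg (q ∷ qs) = ≤-trans (maxℚ-nonneg qs) (p≤q⊔p q (maxℚ qs))

maxℕ-*≤ : ∀ {d b ms} → All (λ m → m * d ≤ b) ms → maxℕ ms * d ≤ b
maxℕ-*≤ []                      = z≤n
maxℕ-*≤ {d} {ms = m ∷ ms} (m*d≤b ∷ ms*d≤b) =
  ≤ℕ-trans (≤-reflexive (*-distribʳ-⊔ d m (maxℕ ms))) (⊔-lub m*d≤b (maxℕ-*≤ ms*d≤b))

-- ratio k (suc m) normalises (+ k) / suc m; comparing through ℚᵘ avoids the gcd.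
ratio≤mkℚ⇒*≤* : ∀ k m p d-1 .(c : Coprime p (suc d-1)) →
  ratio k (suc m) ≤ℚ mkℚ (ℤ.+ p) d-1 c → k * suc d-1 ≤ p * suc m
ratio≤mkℚ⇒*≤* k m p d-1 c k/m≤p/d
  with ℚᵘ.≤-respˡ-≃ (toℚᵘ-fromℚᵘ (mkℚᵘ (ℤ.+ k) m)) (toℚᵘ-mono-≤ k/m≤p/d)
... | ℚᵘ.*≤* cross rewrite sym (ℤ.pos-* k (suc d-1)) | sym (ℤ.pos-* p (suc m)) with cross
...   | +≤+ k*d≤p*m = k*d≤p*m

*≤*⇒ratio≤mkℚ : ∀ k m p d-1 .(c : Coprime p (suc d-1)) →
  k * suc d-1 ≤ p * m → ratio k m ≤ℚ mkℚ (ℤ.+ p) d-1 c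
*≤*⇒ratio≤mkℚ k zero    p d-1 c _       = nonNegative⁻¹ _
*≤*⇒ratio≤mkℚ k (suc m) p d-1 c k*d≤p*m = toℚᵘ-cancel-≤
  (ℚᵘ.≤-respˡ-≃ (ℚᵘ.≃-sym (toℚᵘ-fromℚᵘ (mkℚᵘ (ℤ.+ k) m))) (ℚᵘ.*≤* cross))
  where
  cross : ℤ.+ k ℤ.* ℤ.+ suc d-1 ℤ.≤ ℤ.+ p ℤ.* ℤ.+ suc m
  cross rewrite sym (ℤ.pos-* k (suc d-1)) | sym (ℤ.pos-* p (suc m)) = +≤+ k*d≤p*m

0≤a : ∀ K → 0ℚ ≤ℚ a K
0≤a K = maxℚ-nonneg (map (λ U → ratio ∣ U ∣ (∣ U ∣ + ∣ nbhd K U ∣))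
  (filter (λ U → independent K U ∧ nonempty U ≟ true) (allSubsets (n K))))

ratio≤a : (K : Graph) (U : Subset (n K)) → independent K U ≡ true → nonempty U ≡ true →
  ratio ∣ U ∣ (∣ U ∣ + ∣ nbhd K U ∣) ≤ℚ a K
ratio≤a K U U-indep U-nonempty = maxℚ-upper _ (∈-map⁺ (λ V → ratio ∣ V ∣ (∣ V ∣ + ∣ nbhd K V ∣))
  (∈-filter⁺ (λ V → independent K V ∧ nonempty V ≟ true) (allSubsets-complete U)
    (cong₂ _∧_ U-indep U-nonempty)))

∣p∣≡suc⇒∃-inside : ∀ {k} (U : Subset k) {m} → ∣ U ∣ ≡ suc m → ∃ λ x → lookup U x ≡ true
∣p∣≡suc⇒∃-inside (true ∷ U)  _ = 0F , refl
∣p∣≡suc⇒∃-inside (false ∷ U) ∣U∣≡1+m with ∣p∣≡suc⇒∃-inside U ∣U∣≡1+m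
... | x , x∈U = 1+ x , x∈U

nonempty⁺ : ∀ {k} (U : Subset k) {m} → ∣ U ∣ ≡ suc m → nonempty U ≡ true
nonempty⁺ U ∣U∣≡1+m with ∣p∣≡suc⇒∃-inside U ∣U∣≡1+m
... | x , x∈U = anyV-true⁺ (lookup U) x x∈U

a≤mkℚ⇒ABound : (K : Graph) {p d-1 : ℕ} .{c : Coprime p (suc d-1)} →
  a K ≤ℚ mkℚ (ℤ.+ p) d-1 c → ABound K p (suc d-1)
a≤mkℚ⇒ABound K {p} {d-1} {c} a≤p/d U U-indep with ∣ U ∣ in ∣U∣≡k
... | zero  = z≤n
... | suc k = ratio≤mkℚ⇒*≤* (suc k) (k + ∣ nbhd K U ∣) p d-1 c
  (subst (λ k → ratio k (k + ∣ nbhd K U ∣) ≤ℚ mkℚ (ℤ.+ p) d-1 c) ∣U∣≡k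
    (≤-trans (ratio≤a K U U-indep (nonempty⁺ U ∣U∣≡k)) a≤p/d))

α*≤ : (K : Graph) {d b : ℕ} → (∀ U → independent K U ≡ true → ∣ U ∣ * d ≤ b) → α K * d ≤ b
α*≤ K independent⇒*≤ = maxℕ-*≤ (map⁺ (All.map (λ {U} → independent⇒*≤ U)
  (all-filter (λ U → independent K U ≟ true) (allSubsets (n K)))))

i-×ᴳ-≤ : (G H : Graph) → Undirected G → Undirected H →
  ∀ c → 0ℚ ≤ℚ c → a G ≤ℚ c → a H ≤ℚ c → i (G ×ᴳ H) ≤ℚ c
i-×ᴳ-≤ _ _ _ _ (mkℚ -[1+ _ ] _ _) (*≤* ()) _ _
i-×ᴳ-≤ G H G-undirected H-undirected (mkℚ (ℤ.+ p) d-1 c) _ aG≤p/d aH≤p/d =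
  *≤*⇒ratio≤mkℚ (α (G ×ᴳ H)) (n G * n H) p d-1 c (α*≤ (G ×ᴳ H) λ I I-independent →
    RowColumnSplit.∣I∣-bound G H G-undirected H-undirected I I-independent {p}
      (a≤mkℚ⇒ABound G aG≤p/d) (a≤mkℚ⇒ABound H aH≤p/d))

theorem3p1 : (G H : Graph) → IsSimple G → IsSimple H → n G ≥ 1 → n H ≥ 1 →
    i (G ×ᴳ H) ≤ℚ a G ⊔ a H
theorem3p1 G H G-simple H-simple _ _ =
  i-×ᴳ-≤ G H (IsSimple.symmetric G-simple) (IsSimple.symmetric H-simple) (a G ⊔ a H)
    (≤-trans (0≤a G) (p≤p⊔q (a G) (a H))) (p≤p⊔q (a G) (a H)) (p≤q⊔p (a G) (a H))
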